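{- Let $R$ be a consistent triple set and $R'\subseteq R$. Then $R'\subseteq\mathrm{cl}(R\setminus R')$ if and only if $\mathrm{cl}(R\setminus R')=\mathrm{cl}(R)$. In particular, if $\mathrm{cl}(R\setminus R')=\mathrm{cl}(R)$, then $\mathrm{cl}(R\setminus\{r\})=\mathrm{cl}(R)$ for every $r\in R'$.
   Context: A rooted tree $T$ has a distinguished inner vertex (root); leaves are degree-1 vertices; inner vertices other than the root have degree at least 3. A triple $ab|c$ is the rooted binary tree on leaves $a,b,c$ where the path from $a$ to $b$ avoids the path from $c$ to the root; $ab|c=ba|c$. A rooted tree displays $ab|c$ if $a,b,c$ are leaves and the path from $a$ to $b$ does not intersect the path from $c$ to the root; $\mathcal R(T)$ is the set of displayed triples. A triple set is consistent if some rooted tree displays all its triples. $L_S$ is the set of leaves appearing in $S$. For a consistent triple set $S$, $\mathrm{cl}(S)=\bigcap\mathcal R(T)$ over all rooted trees $T$ with leaf set $L_S$ that display $S$. -}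

module Defs where

open import Data.Nat using (ℕ; zero; suc; _≤_)
open import Data.List using (List; []; _∷_; _++_; length)
open import Data.List.Relation.Unary.Any using (Any)
open import Data.List.Relation.Unary.Unique.Propositional using (Unique)
open import Data.List.Membership.Propositional using (_∈_)
open import Data.Maybe using (Maybe; just; nothing)
open import Data.Product using (Σ; ∃; ∃-syntax; _×_; _,_)
open import Data.Sum using (_⊎_)
open import Data.Unit using (⊤)
open import Relation.Binary.PropositionalEquality using (_≡_; _≢_)
open import Relation.Nullary using (¬_)
open import Function.Bundles using (_⇔_)

-- Rooted trees with leaves labelled by natural numbers.
-- A leaf *is* identified with its label.  A (sub)tree is either a leaf
-- or an inner vertex with a list of children.

data Tree : Set where
  leaf : ℕ → Tree
  node : List Tree → Tree

-- Vertices of a tree are addressed by the list of child indices on the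
-- path from the root; the empty address is the root.
mutual
  subtreeAt : Tree → List ℕ → Maybe Tree
  subtreeAt t        []      = just t
  subtreeAt (leaf _) (_ ∷ _) = nothing
  subtreeAt (node ts) (i ∷ p) = childAt ts i p

  childAt : List Tree → ℕ → List ℕ → Maybe Tree
  childAt []       _       _ = nothing
  childAt (t ∷ ts) zero    p = subtreeAt t p
  childAt (t ∷ ts) (suc i) p = childAt ts i p

mutual
  leaves : Tree → List ℕ
  leaves (leaf x)  = x ∷ []
  leaves (node ts) = leavesL ts

  leavesL : List Tree → List ℕ
  leavesL []       = []
  leavesL (t ∷ ts) = leaves t ++ leavesL ts

-- Non-root vertices: an inner non-root vertex has degree ≥ 3, i.e. it
-- has at least 2 children.
mutual
  NonRootOK : Tree → Set
  NonRootOK (leaf _)  = ⊤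
  NonRootOK (node ts) = (2 ≤ length ts) × AllNonRootOK ts

  AllNonRootOK : List Tree → Set
  AllNonRootOK []       = ⊤
  AllNonRootOK (t ∷ ts) = NonRootOK t × AllNonRootOK ts

record RootedTree : Set where
  constructor mkRootedTree
  field
    rootChildren : List Tree
    wellFormed   : AllNonRootOK rootChildren
    distinct     : Unique (leavesL rootChildren)

  tree : Tree
  tree = node rootChildren

open RootedTree public

LeafOf : RootedTree → ℕ → Set
LeafOf T x = x ∈ leaves (tree T)

-- u is an ancestor-or-equal of v (u lies on the path from v to the root)
_⊑_ : List ℕ → List ℕ → Set
u ⊑ v = ∃[ s ] (u ++ s ≡ v)

-- v lies on the path between the vertices p and q
OnPath : List ℕ → List ℕ → List ℕ → Set
OnPath p q v = ((v ⊑ p) ⊎ (v ⊑ q)) × (∀ w → w ⊑ p → w ⊑ q → w ⊑ v)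

record Triple : Set where
  constructor _∣_∣_[_,_,_]
  field
    a b c : ℕ
    a≢b : a ≢ b
    a≢c : a ≢ c
    b≢c : b ≢ c

open Triple public

_≈ₜ_ : Triple → Triple → Set
t ≈ₜ u = (((a t ≡ a u) × (b t ≡ b u)) ⊎ ((a t ≡ b u) × (b t ≡ a u))) × (c t ≡ c u)

Displays : RootedTree → Triple → Set
Displays T t =
  ∃[ pa ] ∃[ pb ] ∃[ pc ]
    (subtreeAt (tree T) pa ≡ just (leaf (a t))) ×
    (subtreeAt (tree T) pb ≡ just (leaf (b t))) ×
    (subtreeAt (tree T) pc ≡ just (leaf (c t))) ×
    (∀ v → OnPath pa pb v → ¬ (v ⊑ pc))

TSet : Set₁
TSet = Triple → Set

⟦_⟧ : List Triple → TSet
⟦ R ⟧ t = Any (t ≈ₜ_) R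

_⊆ₜ_ : TSet → TSet → Set
S ⊆ₜ S' = ∀ t → S t → S' t

_≐ₜ_ : TSet → TSet → Set
S ≐ₜ S' = ∀ t → S t ⇔ S' t

_∖ₜ_ : TSet → TSet → TSet
(S ∖ₜ S') t = S t × ¬ S' t

LeafSet : TSet → ℕ → Set
LeafSet S x = ∃[ t ] (S t × ((x ≡ a t) ⊎ (x ≡ b t) ⊎ (x ≡ c t)))

DisplaysAll : RootedTree → TSet → Set
DisplaysAll T S = ∀ t → S t → Displays T t

Consistent : TSet → Set
Consistent S = ∃[ T ] DisplaysAll T S

cl : TSet → TSet
cl S t = (T : RootedTree) → (∀ x → LeafOf T x ⇔ LeafSet S x) →
         DisplaysAll T S → Displays T t

module Submission where

-- Write S = R ∖ R'.  A rooted tree is *admissible* for a triple set S when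
-- its leaf set is L_S and it displays S; cl(S) is the set of triples
-- displayed by every admissible tree.  Two general facts carry the proof.
--
-- (1) Restriction.  Restricting a rooted tree to the leaves satisfying a
--     decidable predicate (dropping the other leaves and the emptied inner
--     vertices, suppressing inner vertices left with one child) yields a
--     rooted tree on exactly those leaves that keeps every displayed triple on
--     them; display is handled through the address condition 'Separated'.
--     Hence every S ⊆ R, R consistent, has an admissible tree.
-- (2) Sandwich.  If S has an admissible tree, S ⊆ U and U ⊆ cl(S), then S and
--     U have the same leaf set and admissible trees, so cl(S) = cl(U).
--
-- If R' ⊆ cl(S) then R ⊆ cl(S) and (2) with U = R gives cl(S) = cl(R);
-- conversely R' ⊆ R ⊆ cl(R).  For r ∈ R', (2) with U = R ∖ {r} gives the rest.

open import Defs
open import Data.Nat using (ℕ; zero; suc; s≤s; z≤n)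
open import Data.Nat.Properties using (_≟_)
open import Data.List using (List; []; _∷_; _++_; filter)
open import Data.List.Properties using (++-identityʳ; filter-accept; filter-reject; filter-++)
open import Data.List.Relation.Unary.Any using (Any; here; there; any?)
import Data.List.Relation.Unary.Any as Any
open import Data.List.Relation.Unary.Unique.Propositional using (Unique)
open import Data.List.Relation.Unary.Unique.Propositional.Properties using (filter⁺)
open import Data.List.Membership.Propositional using (_∈_; find)
open import Data.List.Membership.Propositional.Properties using (∈-++⁺ˡ; ∈-++⁺ʳ; ∈-++⁻; ∈-filter⁺; ∈-filter⁻)
open import Data.Maybe using (Maybe; just; nothing)
open import Data.Product using (_×_; _,_; proj₁; proj₂; ∃; ∃-syntax; uncurry)
open import Data.Sum using (_⊎_; inj₁; inj₂)
import Data.Sum as Sum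
open import Data.Unit using (⊤; tt)
open import Data.Empty using (⊥; ⊥-elim)
open import Relation.Nullary using (¬_; Dec; yes; no)
open import Relation.Nullary.Decidable.Core using (_×-dec_; _⊎-dec_; ¬?; map′)
open import Relation.Unary using (Decidable)
open import Relation.Binary.PropositionalEquality
  using (_≡_; _≢_; refl; sym; trans; cong₂; subst; module ≡-Reasoning)
open import Function.Bundles using (_⇔_; mk⇔; Equivalence)
import Function.Properties.Equivalence as ⇔

open Equivalence using (to; from)

[]⊑ : ∀ p → [] ⊑ p
[]⊑ p = p , refl

∷⊑∷ : ∀ {x y : ℕ} {v p} → (x ∷ v) ⊑ (y ∷ p) → x ≡ y × v ⊑ p
∷⊑∷ (s , refl) = refl , (s , refl)

⊑∷ : ∀ {x : ℕ} {v p} → v ⊑ p → (x ∷ v) ⊑ (x ∷ p)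
⊑∷ (s , refl) = s , refl

⊑[] : ∀ {v : List ℕ} → v ⊑ [] → v ≡ []
⊑[] {[]} _ = refl
⊑[] {_ ∷ _} (_ , ())

onPath-∷ : ∀ {i pa pb v} → OnPath pa pb v → OnPath (i ∷ pa) (i ∷ pb) (i ∷ v)
onPath-∷ {i} {pa} {pb} {v} (ends , below) = Sum.map ⊑∷ ⊑∷ ends , common
  where
  common : ∀ w → w ⊑ (i ∷ pa) → w ⊑ (i ∷ pb) → w ⊑ (i ∷ v)
  common []      _ _ = []⊑ _
  common (_ ∷ w) p q with ∷⊑∷ p | ∷⊑∷ q
  ... | refl , p' | _ , q' = ⊑∷ (below w p' q')

onPath-∷⁻ : ∀ {i pa pb v} → OnPath (i ∷ pa) (i ∷ pb) (i ∷ v) → OnPath pa pb v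
onPath-∷⁻ {i} (ends , below) =
  Sum.map (λ h → proj₂ (∷⊑∷ h)) (λ h → proj₂ (∷⊑∷ h)) ends ,
  λ w p q → proj₂ (∷⊑∷ (below (i ∷ w) (⊑∷ p) (⊑∷ q)))

onPath-head : ∀ {i pa pb v} → OnPath (i ∷ pa) (i ∷ pb) v → ∃[ v' ] (v ≡ i ∷ v')
onPath-head {i} {pa} {pb} (_ , below) with below (i ∷ []) (pa , refl) (pb , refl)
... | v' , e = v' , sym e

-- A syntactic form of "the path between pa and pb avoids the path from pc to
-- the root": pa and pb leave the root through a common child, and pc either
-- leaves through another child or the same holds one level down.
Separated : List ℕ → List ℕ → List ℕ → Set
Separated []       _        _        = ⊥
Separated (_ ∷ _)  []       _        = ⊥
Separated (i ∷ _)  (j ∷ _)  []       = i ≡ j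
Separated (i ∷ pa) (j ∷ pb) (k ∷ pc) = i ≡ j × (i ≢ k ⊎ Separated pa pb pc)

separated⇒avoids : ∀ pa pb pc → Separated pa pb pc → ∀ v → OnPath pa pb v → ¬ v ⊑ pc
separated⇒avoids (i ∷ pa) (j ∷ pb) [] refl v op v⊑pc with onPath-head op
... | _ , refl with ⊑[] v⊑pc
... | ()
separated⇒avoids (i ∷ pa) (j ∷ pb) (k ∷ pc) (refl , s) v op v⊑pc with onPath-head op
... | v' , refl with ∷⊑∷ v⊑pc | s
... | refl , _     | inj₁ i≢k = i≢k refl
... | refl , v'⊑pc | inj₂ s'  = separated⇒avoids pa pb pc s' v' (onPath-∷⁻ op) v'⊑pc

-- If pa and pb leave the root through different children, the root lies on
-- the path between them, and the root lies on every path to the root.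
diverging⇒meets : ∀ {i j : ℕ} {pa pb pc} → i ≢ j → ¬ (∀ v → OnPath (i ∷ pa) (j ∷ pb) v → ¬ v ⊑ pc)
diverging⇒meets {i} {j} {pa} {pb} {pc} i≢j avoids = avoids [] (inj₁ ([]⊑ _) , below) ([]⊑ pc)
  where
  below : ∀ w → w ⊑ (i ∷ pa) → w ⊑ (j ∷ pb) → w ⊑ []
  below []      _ _ = []⊑ []
  below (_ ∷ w) p q = ⊥-elim (i≢j (trans (sym (proj₁ (∷⊑∷ p))) (proj₁ (∷⊑∷ q))))

avoids⇒separated : ∀ pa pb pc → (∀ v → OnPath pa pb v → ¬ v ⊑ pc) → Separated pa pb pc
avoids⇒separated [] pb pc avoids = avoids [] (inj₁ ([]⊑ []) , λ _ p _ → p) ([]⊑ pc)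
avoids⇒separated (i ∷ pa) [] pc avoids = avoids [] (inj₂ ([]⊑ []) , λ _ _ q → q) ([]⊑ pc)
avoids⇒separated (i ∷ pa) (j ∷ pb) pc avoids with i ≟ j
... | no i≢j = ⊥-elim (diverging⇒meets i≢j avoids)
avoids⇒separated (i ∷ pa) (_ ∷ pb) []       avoids | yes i≡j = i≡j
avoids⇒separated (i ∷ pa) (_ ∷ pb) (k ∷ pc) avoids | yes refl with i ≟ k
... | no i≢k  = refl , inj₁ i≢k
... | yes refl = refl , inj₂ (avoids⇒separated pa pb pc
                   (λ v op v⊑pc → avoids (i ∷ v) (onPath-∷ op) (⊑∷ v⊑pc)))

HasLeaf : Tree → ℕ → Set
HasLeaf t x = ∃[ p ] subtreeAt t p ≡ just (leaf x)

ChildLeaf : List Tree → ℕ → ℕ → Set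
ChildLeaf ts i x = ∃[ p ] childAt ts i p ≡ just (leaf x)

mutual
  hasLeaf⇒∈ : ∀ t {x} → HasLeaf t x → x ∈ leaves t
  hasLeaf⇒∈ (leaf _)  ([] , refl)   = here refl
  hasLeaf⇒∈ (leaf _)  (_ ∷ _ , ())
  hasLeaf⇒∈ (node ts) ([] , ())
  hasLeaf⇒∈ (node ts) (i ∷ p , e)   = childLeaf⇒∈ ts i (p , e)

  childLeaf⇒∈ : ∀ ts i {x} → ChildLeaf ts i x → x ∈ leavesL ts
  childLeaf⇒∈ []       _       (_ , ())
  childLeaf⇒∈ (t ∷ ts) zero    c = ∈-++⁺ˡ (hasLeaf⇒∈ t c)
  childLeaf⇒∈ (t ∷ ts) (suc i) c = ∈-++⁺ʳ (leaves t) (childLeaf⇒∈ ts i c)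

mutual
  ∈⇒hasLeaf : ∀ t {x} → x ∈ leaves t → HasLeaf t x
  ∈⇒hasLeaf (leaf _)  (here refl) = [] , refl
  ∈⇒hasLeaf (leaf _)  (there ())
  ∈⇒hasLeaf (node ts) x∈ with ∈⇒childLeaf ts x∈
  ... | i , p , e = i ∷ p , e

  ∈⇒childLeaf : ∀ ts {x} → x ∈ leavesL ts → ∃[ i ] ChildLeaf ts i x
  ∈⇒childLeaf (t ∷ ts) x∈ with ∈-++⁻ (leaves t) x∈
  ... | inj₁ x∈t = zero , ∈⇒hasLeaf t x∈t
  ... | inj₂ x∈ts with ∈⇒childLeaf ts x∈ts
  ...   | i , c = suc i , c

SeparatedTriple : Tree → ℕ → ℕ → ℕ → Set
SeparatedTriple t x y z = ∃[ pa ] ∃[ pb ] ∃[ pc ]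
  (subtreeAt t pa ≡ just (leaf x) × subtreeAt t pb ≡ just (leaf y) ×
   subtreeAt t pc ≡ just (leaf z) × Separated pa pb pc)

displays⇒separated : ∀ T t → Displays T t → SeparatedTriple (tree T) (a t) (b t) (c t)
displays⇒separated T t (pa , pb , pc , ea , eb , ec , avoids) =
  pa , pb , pc , ea , eb , ec , avoids⇒separated pa pb pc avoids

separated⇒displays : ∀ T t → SeparatedTriple (tree T) (a t) (b t) (c t) → Displays T t
separated⇒displays T t (pa , pb , pc , ea , eb , ec , s) =
  pa , pb , pc , ea , eb , ec , separated⇒avoids pa pb pc s

SameChild : List Tree → ℕ → ℕ → Set
SameChild ts x y = ∃[ i ] (ChildLeaf ts i x × ChildLeaf ts i y)

SplitAtRoot : List Tree → ℕ → ℕ → ℕ → Set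
SplitAtRoot ts x y z = ∃[ i ] ∃[ k ]
  (i ≢ k × ChildLeaf ts i x × ChildLeaf ts i y × ChildLeaf ts k z)

SeparatedBelow : List Tree → ℕ → ℕ → ℕ → ℕ → Set
SeparatedBelow ts i x y z = ∃[ pa ] ∃[ pb ] ∃[ pc ]
  (childAt ts i pa ≡ just (leaf x) × childAt ts i pb ≡ just (leaf y) ×
   childAt ts i pc ≡ just (leaf z) × Separated pa pb pc)

SeparatedAtNode : List Tree → ℕ → ℕ → ℕ → Set
SeparatedAtNode ts x y z = SplitAtRoot ts x y z ⊎ ∃[ i ] SeparatedBelow ts i x y z

separated-node : ∀ ts {x y z} → SeparatedTriple (node ts) x y z → SeparatedAtNode ts x y z
separated-node ts ([] , _ , _ , () , _)
separated-node ts (_ ∷ _ , [] , _ , _ , _ , _ , ())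
separated-node ts (_ ∷ _ , _ ∷ _ , [] , _ , _ , () , _)
separated-node ts (i ∷ pa , _ ∷ pb , k ∷ pc , ea , eb , ec , refl , inj₁ i≢k) =
  inj₁ (i , k , i≢k , (pa , ea) , (pb , eb) , (pc , ec))
separated-node ts (i ∷ pa , _ ∷ pb , k ∷ pc , ea , eb , ec , refl , inj₂ s) with i ≟ k
... | yes refl = inj₂ (i , pa , pb , pc , ea , eb , ec , s)
... | no i≢k   = inj₁ (i , k , i≢k , (pa , ea) , (pb , eb) , (pc , ec))

node-separated : ∀ ts {x y z} → SeparatedAtNode ts x y z → SeparatedTriple (node ts) x y z
node-separated ts (inj₁ (i , k , i≢k , (pa , ea) , (pb , eb) , (pc , ec))) =
  i ∷ pa , i ∷ pb , k ∷ pc , ea , eb , ec , refl , inj₁ i≢k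
node-separated ts (inj₂ (i , pa , pb , pc , ea , eb , ec , s)) =
  i ∷ pa , i ∷ pb , i ∷ pc , ea , eb , ec , refl , inj₂ s

-- Restriction of a tree to the leaves satisfying a decidable predicate

module Restriction (P : ℕ → Set) (P? : Decidable P) where

  -- A restricted subtree may vanish ('nothing'); a leaf survives iff it is a P-leaf.
  restrictLeaf : (x : ℕ) → Dec (P x) → Maybe Tree
  restrictLeaf x (yes _) = just (leaf x)
  restrictLeaf x (no _)  = nothing

  collapse : List Tree → Maybe Tree
  collapse []           = nothing
  collapse (t ∷ [])     = just t
  collapse (t ∷ u ∷ ts) = just (node (t ∷ u ∷ ts))

  _∷?_ : Maybe Tree → List Tree → List Tree
  nothing ∷? ts = ts
  just t  ∷? ts = t ∷ ts

  mutual
    restrict : Tree → Maybe Tree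
    restrict (leaf x)  = restrictLeaf x (P? x)
    restrict (node ts) = collapse (restrictAll ts)

    restrictAll : List Tree → List Tree
    restrictAll []       = []
    restrictAll (t ∷ ts) = restrict t ∷? restrictAll ts

  NonRootOKᴹ : Maybe Tree → Set
  NonRootOKᴹ nothing  = ⊤
  NonRootOKᴹ (just t) = NonRootOK t

  collapse-ok : ∀ ts → AllNonRootOK ts → NonRootOKᴹ (collapse ts)
  collapse-ok []           _        = tt
  collapse-ok (t ∷ [])     (ok , _) = ok
  collapse-ok (t ∷ u ∷ ts) ok       = s≤s (s≤s z≤n) , ok

  ∷?-ok : ∀ m ts → NonRootOKᴹ m → AllNonRootOK ts → AllNonRootOK (m ∷? ts)
  ∷?-ok nothing  ts _  oks = oks
  ∷?-ok (just t) ts ok oks = ok , oks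

  restrictLeaf-ok : ∀ x d → NonRootOKᴹ (restrictLeaf x d)
  restrictLeaf-ok x (yes _) = tt
  restrictLeaf-ok x (no _)  = tt

  mutual
    restrict-ok : ∀ t → NonRootOKᴹ (restrict t)
    restrict-ok (leaf x)  = restrictLeaf-ok x (P? x)
    restrict-ok (node ts) = collapse-ok (restrictAll ts) (restrictAll-ok ts)

    restrictAll-ok : ∀ ts → AllNonRootOK (restrictAll ts)
    restrictAll-ok []       = tt
    restrictAll-ok (t ∷ ts) = ∷?-ok (restrict t) (restrictAll ts) (restrict-ok t) (restrictAll-ok ts)

  leavesᴹ : Maybe Tree → List ℕ
  leavesᴹ nothing  = []
  leavesᴹ (just t) = leaves t

  collapse-leaves : ∀ ts → leavesᴹ (collapse ts) ≡ leavesL ts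
  collapse-leaves []           = refl
  collapse-leaves (t ∷ [])     = sym (++-identityʳ (leaves t))
  collapse-leaves (t ∷ u ∷ ts) = refl

  ∷?-leaves : ∀ m ts → leavesL (m ∷? ts) ≡ leavesᴹ m ++ leavesL ts
  ∷?-leaves nothing  ts = refl
  ∷?-leaves (just t) ts = refl

  restrictLeaf-leaves : ∀ x d → leavesᴹ (restrictLeaf x d) ≡ filter P? (x ∷ [])
  restrictLeaf-leaves x (yes px)  = sym (filter-accept P? px)
  restrictLeaf-leaves x (no ¬px)  = sym (filter-reject P? ¬px)

  mutual
    restrict-leaves : ∀ t → leavesᴹ (restrict t) ≡ filter P? (leaves t)
    restrict-leaves (leaf x)  = restrictLeaf-leaves x (P? x)
    restrict-leaves (node ts) = trans (collapse-leaves (restrictAll ts)) (restrictAll-leaves ts)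

    restrictAll-leaves : ∀ ts → leavesL (restrictAll ts) ≡ filter P? (leavesL ts)
    restrictAll-leaves []       = refl
    restrictAll-leaves (t ∷ ts) = begin
      leavesL (restrict t ∷? restrictAll ts)
        ≡⟨ ∷?-leaves (restrict t) (restrictAll ts) ⟩
      leavesᴹ (restrict t) ++ leavesL (restrictAll ts)
        ≡⟨ cong₂ _++_ (restrict-leaves t) (restrictAll-leaves ts) ⟩
      filter P? (leaves t) ++ filter P? (leavesL ts)
        ≡⟨ sym (filter-++ P? (leaves t) (leavesL ts)) ⟩
      filter P? (leavesL (t ∷ ts)) ∎
      where open ≡-Reasoning

  HasLeafᴹ : Maybe Tree → ℕ → Set
  HasLeafᴹ nothing  _ = ⊥
  HasLeafᴹ (just t) x = HasLeaf t x

  restrict-hasLeaf : ∀ t {x} → HasLeaf t x → P x → HasLeafᴹ (restrict t) x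
  restrict-hasLeaf t {x} h px = located (restrict t) x∈
    where
    x∈ : x ∈ leavesᴹ (restrict t)
    x∈ = subst (x ∈_) (sym (restrict-leaves t)) (∈-filter⁺ P? (hasLeaf⇒∈ t h) px)
    located : ∀ m → x ∈ leavesᴹ m → HasLeafᴹ m x
    located (just u) x∈u = ∈⇒hasLeaf u x∈u

  restrictAll-childLeaf : ∀ ts i {x} → ChildLeaf ts i x → P x → ∃[ j ] ChildLeaf (restrictAll ts) j x
  restrictAll-childLeaf ts i {x} c px = ∈⇒childLeaf (restrictAll ts)
    (subst (x ∈_) (sym (restrictAll-leaves ts)) (∈-filter⁺ P? (childLeaf⇒∈ ts i c) px))

  SeparatedTripleᴹ : Maybe Tree → ℕ → ℕ → ℕ → Set
  SeparatedTripleᴹ nothing  _ _ _ = ⊥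
  SeparatedTripleᴹ (just t) x y z = SeparatedTriple t x y z

  sameChild-here : ∀ m ts {x y} → HasLeafᴹ m x → HasLeafᴹ m y → SameChild (m ∷? ts) x y
  sameChild-here (just t) ts hx hy = zero , hx , hy

  sameChild-there : ∀ m ts {x y} → SameChild ts x y → SameChild (m ∷? ts) x y
  sameChild-there nothing  ts s              = s
  sameChild-there (just t) ts (i , cx , cy)  = suc i , cx , cy

  split-here : ∀ m ts {x y z} → HasLeafᴹ m x → HasLeafᴹ m y → ∃[ k ] ChildLeaf ts k z →
               SplitAtRoot (m ∷? ts) x y z
  split-here (just t) ts hx hy (k , cz) = zero , suc k , (λ ()) , hx , hy , cz

  split-hereᶜ : ∀ m ts {x y z} → HasLeafᴹ m z → SameChild ts x y → SplitAtRoot (m ∷? ts) x y z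
  split-hereᶜ (just t) ts hz (i , cx , cy) = suc i , zero , (λ ()) , cx , cy , hz

  split-there : ∀ m ts {x y z} → SplitAtRoot ts x y z → SplitAtRoot (m ∷? ts) x y z
  split-there nothing  ts s = s
  split-there (just t) ts (i , k , i≢k , cx , cy , cz) =
    suc i , suc k , (λ { refl → i≢k refl }) , cx , cy , cz

  below-here : ∀ m ts {x y z} → SeparatedTripleᴹ m x y z → ∃[ i ] SeparatedBelow (m ∷? ts) i x y z
  below-here (just t) ts s = zero , s

  below-there : ∀ m ts {x y z} → ∃[ i ] SeparatedBelow ts i x y z → ∃[ i ] SeparatedBelow (m ∷? ts) i x y z
  below-there nothing  ts s       = s
  below-there (just t) ts (i , s) = suc i , s

  restrictAll-sameChild : ∀ ts i {x y} → ChildLeaf ts i x → ChildLeaf ts i y → P x → P y →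
                          SameChild (restrictAll ts) x y
  restrictAll-sameChild []       _       (_ , ()) _ _ _
  restrictAll-sameChild (t ∷ ts) zero    cx cy px py =
    sameChild-here (restrict t) (restrictAll ts) (restrict-hasLeaf t cx px) (restrict-hasLeaf t cy py)
  restrictAll-sameChild (t ∷ ts) (suc i) cx cy px py =
    sameChild-there (restrict t) (restrictAll ts) (restrictAll-sameChild ts i cx cy px py)

  restrictAll-split : ∀ ts {x y z} → SplitAtRoot ts x y z → P x → P y → P z →
                      SplitAtRoot (restrictAll ts) x y z
  restrictAll-split [] (_ , _ , _ , (_ , ()) , _)
  restrictAll-split (t ∷ ts) (zero , zero , i≢k , _) _ _ _ = ⊥-elim (i≢k refl)
  restrictAll-split (t ∷ ts) (zero , suc k , _ , cx , cy , cz) px py pz =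
    split-here (restrict t) (restrictAll ts) (restrict-hasLeaf t cx px) (restrict-hasLeaf t cy py)
      (restrictAll-childLeaf ts k cz pz)
  restrictAll-split (t ∷ ts) (suc i , zero , _ , cx , cy , cz) px py pz =
    split-hereᶜ (restrict t) (restrictAll ts) (restrict-hasLeaf t cz pz)
      (restrictAll-sameChild ts i cx cy px py)
  restrictAll-split (t ∷ ts) (suc i , suc k , i≢k , cx , cy , cz) px py pz =
    split-there (restrict t) (restrictAll ts)
      (restrictAll-split ts (i , k , (λ { refl → i≢k refl }) , cx , cy , cz) px py pz)

  collapse-separated : ∀ ts {x y z} → SeparatedAtNode ts x y z → SeparatedTripleᴹ (collapse ts) x y z
  collapse-separated []       (inj₁ (_ , _ , _ , (_ , ()) , _))
  collapse-separated []       (inj₂ (_ , _ , _ , _ , () , _))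
  collapse-separated (t ∷ []) (inj₁ (zero , zero , i≢k , _)) = ⊥-elim (i≢k refl)
  collapse-separated (t ∷ []) (inj₁ (zero , suc k , _ , _ , _ , (_ , ())))
  collapse-separated (t ∷ []) (inj₁ (suc i , _ , _ , (_ , ()) , _))
  collapse-separated (t ∷ []) (inj₂ (zero , s)) = s
  collapse-separated (t ∷ []) (inj₂ (suc i , _ , _ , _ , () , _))
  collapse-separated (t ∷ u ∷ ts) s = node-separated (t ∷ u ∷ ts) s

  mutual
    restrict-separated : ∀ t {x y z} → SeparatedTriple t x y z → P x → P y → P z →
                         SeparatedTripleᴹ (restrict t) x y z
    restrict-separated (leaf _)  ([] , _ , _ , _ , _ , _ , ())
    restrict-separated (leaf _)  (_ ∷ _ , _ , _ , () , _)
    restrict-separated (node ts) s px py pz =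
      collapse-separated (restrictAll ts) (restrictAll-separated ts (separated-node ts s) px py pz)

    restrictAll-separated : ∀ ts {x y z} → SeparatedAtNode ts x y z → P x → P y → P z →
                            SeparatedAtNode (restrictAll ts) x y z
    restrictAll-separated ts (inj₁ split)   px py pz = inj₁ (restrictAll-split ts split px py pz)
    restrictAll-separated ts (inj₂ (i , s)) px py pz = inj₂ (restrictAll-below ts i s px py pz)

    restrictAll-below : ∀ ts i {x y z} → SeparatedBelow ts i x y z → P x → P y → P z →
                        ∃[ j ] SeparatedBelow (restrictAll ts) j x y z
    restrictAll-below []       _       (_ , _ , _ , () , _)
    restrictAll-below (t ∷ ts) zero    s px py pz =
      below-here (restrict t) (restrictAll ts) (restrict-separated t s px py pz)
    restrictAll-below (t ∷ ts) (suc i) s px py pz =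
      below-there (restrict t) (restrictAll ts) (restrictAll-below ts i s px py pz)

  -- The restriction of a rooted tree; the root is kept even if it is left
  -- with a single child, as the root may have any degree.
  restrictTree : RootedTree → RootedTree
  restrictTree (mkRootedTree ts _ distinct) =
    mkRootedTree (restrictAll ts) (restrictAll-ok ts)
      (subst Unique (sym (restrictAll-leaves ts)) (filter⁺ P? distinct))

  restrictTree-leaf : ∀ T x → LeafOf (restrictTree T) x ⇔ (LeafOf T x × P x)
  restrictTree-leaf (mkRootedTree ts _ _) x = mk⇔
    (λ l → ∈-filter⁻ P? (subst (x ∈_) (restrictAll-leaves ts) l))
    (λ (l , px) → subst (x ∈_) (sym (restrictAll-leaves ts)) (∈-filter⁺ P? l px))

  restrictTree-displays : ∀ T t → Displays T t → P (a t) → P (b t) → P (c t) →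
                          Displays (restrictTree T) t
  restrictTree-displays T@(mkRootedTree ts _ _) t d pa pb pc =
    separated⇒displays (restrictTree T) t (node-separated (restrictAll ts)
      (restrictAll-separated ts (separated-node ts (displays⇒separated T t d)) pa pb pc))

LeafOfTriple : ℕ → Triple → Set
LeafOfTriple x t = (x ≡ a t) ⊎ (x ≡ b t) ⊎ (x ≡ c t)

leafOfTriple? : ∀ x t → Dec (LeafOfTriple x t)
leafOfTriple? x t = (x ≟ a t) ⊎-dec (x ≟ b t) ⊎-dec (x ≟ c t)

leafOfTriple-resp : ∀ {x t u} → t ≈ₜ u → LeafOfTriple x t → LeafOfTriple x u
leafOfTriple-resp (inj₁ (a≡ , _) , _)  (inj₁ x≡)         = inj₁ (trans x≡ a≡)
leafOfTriple-resp (inj₁ (_ , b≡) , _)  (inj₂ (inj₁ x≡))  = inj₂ (inj₁ (trans x≡ b≡))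
leafOfTriple-resp (inj₂ (a≡ , _) , _)  (inj₁ x≡)         = inj₂ (inj₁ (trans x≡ a≡))
leafOfTriple-resp (inj₂ (_ , b≡) , _)  (inj₂ (inj₁ x≡))  = inj₁ (trans x≡ b≡)
leafOfTriple-resp (_ , c≡)             (inj₂ (inj₂ x≡))  = inj₂ (inj₂ (trans x≡ c≡))

≈ₜ-refl : ∀ t → t ≈ₜ t
≈ₜ-refl t = inj₁ (refl , refl) , refl

≈ₜ-trans : ∀ {t u w} → t ≈ₜ u → u ≈ₜ w → t ≈ₜ w
≈ₜ-trans (inj₁ (e₁ , e₂) , e₃) (inj₁ (f₁ , f₂) , f₃) = inj₁ (trans e₁ f₁ , trans e₂ f₂) , trans e₃ f₃
≈ₜ-trans (inj₁ (e₁ , e₂) , e₃) (inj₂ (f₁ , f₂) , f₃) = inj₂ (trans e₁ f₁ , trans e₂ f₂) , trans e₃ f₃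
≈ₜ-trans (inj₂ (e₁ , e₂) , e₃) (inj₁ (f₁ , f₂) , f₃) = inj₂ (trans e₁ f₂ , trans e₂ f₁) , trans e₃ f₃
≈ₜ-trans (inj₂ (e₁ , e₂) , e₃) (inj₂ (f₁ , f₂) , f₃) = inj₁ (trans e₁ f₂ , trans e₂ f₁) , trans e₃ f₃

≈ₜ? : ∀ t u → Dec (t ≈ₜ u)
≈ₜ? t u = (((a t ≟ a u) ×-dec (b t ≟ b u)) ⊎-dec ((a t ≟ b u) ×-dec (b t ≟ a u))) ×-dec (c t ≟ c u)

⟦⟧? : ∀ L t → Dec (⟦ L ⟧ t)
⟦⟧? L t = any? (≈ₜ? t) L

⟦⟧-resp : ∀ L {t u} → t ≈ₜ u → ⟦ L ⟧ u → ⟦ L ⟧ t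
⟦⟧-resp L {t} {u} t≈u = Any.map (λ {w} u≈w → ≈ₜ-trans {t} {u} {w} t≈u u≈w)

leafSet? : ∀ R R' x → Dec (LeafSet (⟦ R ⟧ ∖ₜ ⟦ R' ⟧) x)
leafSet? R R' x = map′ fromAny toAny (any? (λ u → ¬? (⟦⟧? R' u) ×-dec leafOfTriple? x u) R)
  where
  Witness : Triple → Set
  Witness u = ¬ ⟦ R' ⟧ u × LeafOfTriple x u

  fromAny : Any Witness R → LeafSet (⟦ R ⟧ ∖ₜ ⟦ R' ⟧) x
  fromAny w with find w
  ... | u , u∈R , ¬R'u , lf = u , (Any.map (λ { refl → ≈ₜ-refl u }) u∈R , ¬R'u) , lf

  toAny : LeafSet (⟦ R ⟧ ∖ₜ ⟦ R' ⟧) x → Any Witness R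
  toAny (t , (Rt , ¬R't) , lf) =
    Any.map (λ {u} t≈u → (λ R'u → ¬R't (⟦⟧-resp R' {t} {u} t≈u R'u)) , leafOfTriple-resp {x} {t} {u} t≈u lf) Rt

displayed-leaf : ∀ T t {x} → Displays T t → LeafOfTriple x t → LeafOf T x
displayed-leaf T t (pa , _  , _  , ea , _  , _  , _) (inj₁ refl)        = hasLeaf⇒∈ (tree T) (pa , ea)
displayed-leaf T t (_  , pb , _  , _  , eb , _  , _) (inj₂ (inj₁ refl)) = hasLeaf⇒∈ (tree T) (pb , eb)
displayed-leaf T t (_  , _  , pc , _  , _  , ec , _) (inj₂ (inj₂ refl)) = hasLeaf⇒∈ (tree T) (pc , ec)

≐ₜ-sym : ∀ {S U} → S ≐ₜ U → U ≐ₜ S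
≐ₜ-sym S≐U t = ⇔.sym (S≐U t)

≐ₜ-trans : ∀ {S U V} → S ≐ₜ U → U ≐ₜ V → S ≐ₜ V
≐ₜ-trans S≐U U≐V t = ⇔.trans (S≐U t) (U≐V t)

Admissible : TSet → RootedTree → Set
Admissible S T = (∀ x → LeafOf T x ⇔ LeafSet S x) × DisplaysAll T S

cl-cong : ∀ {S U} → (∀ T → Admissible S T → Admissible U T) → (∀ T → Admissible U T → Admissible S T) →
          cl S ≐ₜ cl U
cl-cong S→U U→S t = mk⇔
  (λ t∈clS T leavesT dU → uncurry (t∈clS T) (U→S T (leavesT , dU)))
  (λ t∈clU T leavesT dS → uncurry (t∈clU T) (S→U T (leavesT , dS)))

⊆-cl : ∀ S → S ⊆ₜ cl S
⊆-cl S t St T _ dS = dS t St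

∖ₜ-⊆ : ∀ {S U} → (S ∖ₜ U) ⊆ₜ S
∖ₜ-⊆ t = proj₁

leafSet-mono : ∀ {S U} → S ⊆ₜ U → ∀ x → LeafSet S x → LeafSet U x
leafSet-mono S⊆U x (t , St , lf) = t , S⊆U t St , lf

cl-leaf : ∀ {S T t x} → Admissible S T → cl S t → LeafOfTriple x t → LeafSet S x
cl-leaf {T = T} {t} {x} (leavesT , dS) t∈clS lf =
  to (leavesT x) (displayed-leaf T t (t∈clS T leavesT dS) lf)

closure-sandwich : ∀ {S U} → ∃ (Admissible S) → S ⊆ₜ U → U ⊆ₜ cl S → cl S ≐ₜ cl U
closure-sandwich {S} {U} (T₀ , adm₀) S⊆U U⊆clS = cl-cong S→U U→S
  where
  sameLeaves : ∀ x → LeafSet S x ⇔ LeafSet U x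
  sameLeaves x = mk⇔ (leafSet-mono S⊆U x) (λ (t , Ut , lf) → cl-leaf {T = T₀} {t} {x} adm₀ (U⊆clS t Ut) lf)

  S→U : ∀ T → Admissible S T → Admissible U T
  S→U T (leavesT , dS) = (λ x → ⇔.trans (leavesT x) (sameLeaves x)) , (λ t Ut → U⊆clS t Ut T leavesT dS)

  U→S : ∀ T → Admissible U T → Admissible S T
  U→S T (leavesT , dU) = (λ x → ⇔.trans (leavesT x) (⇔.sym (sameLeaves x))) , (λ t St → dU t (S⊆U t St))

-- A subset S of a consistent R with decidable leaf set has an admissible
-- tree: restrict a tree displaying R to L_S.
restriction-admissible : ∀ {R S} → Consistent R → S ⊆ₜ R → (∀ x → Dec (LeafSet S x)) → ∃ (Admissible S)
restriction-admissible {R} {S} (T , dR) S⊆R L? = restrictTree T , leavesT' , displaysS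
  where
  open Restriction (LeafSet S) L?

  leavesT' : ∀ x → LeafOf (restrictTree T) x ⇔ LeafSet S x
  leavesT' x = ⇔.trans (restrictTree-leaf T x) (mk⇔ proj₂
    (λ l@(t , St , lf) → displayed-leaf T t (dR t (S⊆R t St)) lf , l))

  displaysS : DisplaysAll (restrictTree T) S
  displaysS t St = restrictTree-displays T t (dR t (S⊆R t St))
    (t , St , inj₁ refl) (t , St , inj₂ (inj₁ refl)) (t , St , inj₂ (inj₂ refl))

⊆-cl-∖ : ∀ {X Y} → (∀ t → Dec (X t)) → X ⊆ₜ cl (Y ∖ₜ X) → Y ⊆ₜ cl (Y ∖ₜ X)
⊆-cl-∖ {X} {Y} X? X⊆cl t Yt with X? t
... | yes Xt  = X⊆cl t Xt
... | no ¬Xt  = ⊆-cl (Y ∖ₜ X) t (Yt , ¬Xt)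

mainTheorem20 : (R R' : List Triple) → Consistent ⟦ R ⟧ → ⟦ R' ⟧ ⊆ₜ ⟦ R ⟧ →
    ((⟦ R' ⟧ ⊆ₜ cl (⟦ R ⟧ ∖ₜ ⟦ R' ⟧)) ⇔ (cl (⟦ R ⟧ ∖ₜ ⟦ R' ⟧) ≐ₜ cl ⟦ R ⟧))
    × (cl (⟦ R ⟧ ∖ₜ ⟦ R' ⟧) ≐ₜ cl ⟦ R ⟧ →
       ∀ r → ⟦ R' ⟧ r → cl (⟦ R ⟧ ∖ₜ ⟦ r ∷ [] ⟧) ≐ₜ cl ⟦ R ⟧)
mainTheorem20 R R' consistent R'⊆R = mk⇔ sufficient necessary , singleRemoval
  where
  S : TSet
  S = ⟦ R ⟧ ∖ₜ ⟦ R' ⟧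

  admissibleS : ∃ (Admissible S)
  admissibleS = restriction-admissible consistent ∖ₜ-⊆ (leafSet? R R')

  sufficient : ⟦ R' ⟧ ⊆ₜ cl S → cl S ≐ₜ cl ⟦ R ⟧
  sufficient R'⊆clS = closure-sandwich admissibleS ∖ₜ-⊆ (⊆-cl-∖ (⟦⟧? R') R'⊆clS)

  necessary : cl S ≐ₜ cl ⟦ R ⟧ → ⟦ R' ⟧ ⊆ₜ cl S
  necessary clS≐clR t R't = from (clS≐clR t) (⊆-cl ⟦ R ⟧ t (R'⊆R t R't))

  singleRemoval : cl S ≐ₜ cl ⟦ R ⟧ → ∀ r → ⟦ R' ⟧ r → cl (⟦ R ⟧ ∖ₜ ⟦ r ∷ [] ⟧) ≐ₜ cl ⟦ R ⟧
  singleRemoval clS≐clR r R'r = ≐ₜ-trans (≐ₜ-sym (closure-sandwich admissibleS S⊆U U⊆clS)) clS≐clR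
    where
    S⊆U : S ⊆ₜ (⟦ R ⟧ ∖ₜ ⟦ r ∷ [] ⟧)
    S⊆U t (Rt , ¬R't) = Rt , λ { (here t≈r) → ¬R't (⟦⟧-resp R' {t} {r} t≈r R'r) }

    U⊆clS : (⟦ R ⟧ ∖ₜ ⟦ r ∷ [] ⟧) ⊆ₜ cl S
    U⊆clS t (Rt , _) = from (clS≐clR t) (⊆-cl ⟦ R ⟧ t Rt)
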